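{- Let $\ell_1, \ell_2, \dots$ be the sequence defined by $\ell_1 = 1$ and, for $n\ge1$, $$\ell_{n+1} = \ell_n + \sum_{\sigma \in \mathrm{Dec}_n} \vec{\ell}(n,\sigma) \cdot \ell_{\sigma^{+}}.$$ Then for every $n \geq 0$, $d_n = \ell_{n+1}$.
   Context: $\mathrm{Dec}_n$ is the set of all strictly decreasing non-empty finite sequences over $\{1, \dots, n-1\}$ (empty if $n\le1$); for $\sigma \in \mathrm{Dec}_n$, $\sigma^{+}$ denotes its last (smallest) element. For $\sigma = n_0 n_1 \dots n_s \in \mathrm{Dec}_n$ (with $n_0 > \dots > n_s$), $\vec{\ell}(n,\sigma) = \ell_{n-n_0} \cdot \prod_{i=1}^s \ell_{n_{i-1}-n_i}$. The Catalan numbers are defined by $d_0 = 1$ and $d_{m+1} = \sum_{i=0}^m d_i d_{m-i}$. -}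

module Defs where

open import Data.Nat using (ℕ; zero; suc; _∸_; _*_)
open import Data.List using (List; []; _∷_; _++_; map; zipWith; reverse; downFrom)
open import Data.Nat.ListAction using (sum)

-- Catalan numbers: d 0 = 1, d (m+1) = Σ_{i=0}^{m} d i * d (m - i).
-- catalansRev m = [d m, d (m-1), ..., d 0]
catalansRev : ℕ → List ℕ
catalansRev zero = 1 ∷ []
catalansRev (suc m) = sum (zipWith _*_ xs (reverse xs)) ∷ xs
  where xs = catalansRev m

headOr0 : List ℕ → ℕ
headOr0 [] = 0
headOr0 (x ∷ _) = x

d : ℕ → ℕ
d m = headOr0 (catalansRev m)

sublists : List ℕ → List (List ℕ)
sublists [] = [] ∷ []
sublists (x ∷ xs) = map (x ∷_) (sublists xs) ++ sublists xs

nonEmpty : List (List ℕ) → List (List ℕ)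
nonEmpty [] = []
nonEmpty ([] ∷ ys) = nonEmpty ys
nonEmpty ((x ∷ xs) ∷ ys) = (x ∷ xs) ∷ nonEmpty ys

-- Dec n : all strictly decreasing non-empty sequences over {1,…,n-1},
-- each listed exactly once (sublists of [n-1, n-2, …, 1]).
-- (downFrom (n ∸ 1) = [n-2, …, 0]; we shift by one.)
Dec : ℕ → List (List ℕ)
Dec n = nonEmpty (sublists (map suc (downFrom (n ∸ 1))))

-- σ⁺ : last (smallest) element (default 0 for the empty list; never used)
lastElem : List ℕ → ℕ
lastElem [] = 0
lastElem (x ∷ []) = x
lastElem (x ∷ y ∷ ys) = lastElem (y ∷ ys)

gapProd : (ℕ → ℕ) → ℕ → List ℕ → ℕ
gapProd ℓ p [] = 1
gapProd ℓ p (x ∷ xs) = ℓ (p ∸ x) * gapProd ℓ x xs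

vecℓ : (ℕ → ℕ) → ℕ → List ℕ → ℕ
vecℓ ℓ n σ = gapProd ℓ n σ

decSum : (ℕ → ℕ) → ℕ → ℕ
decSum ℓ n = sum (map (λ σ → vecℓ ℓ n σ * ℓ (lastElem σ)) (Dec n))

-- Read σ ∈ Dec n as a descending chain n > n₀ > … > nₛ ≥ 1 weighted by ℓ of its gaps and of its
-- last element; adding the empty chain (weight ℓ n) turns ℓ n + decSum ℓ n into a sum over all
-- chains below n. Splitting off the largest element n₀ = m gives the chain sum from p over
-- {1,…,m} as ℓ (p − m) · ℓ (m + 1) plus the chain sum over {1,…,m−1}, so by induction
-- ℓ (m + 2) = Σ_{j ≤ m} ℓ (m + 1 − j) · ℓ (j + 1): the Catalan recurrence for ℓ (n + 1).
module Submission where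

open import Defs
open import Data.Nat using (ℕ; zero; suc; _+_; _*_; _∸_; _≥_; s≤s; z≤n)
open import Data.Nat.Properties using (*-identityˡ; *-identityʳ; *-assoc; *-comm; *-zeroʳ; *-distribˡ-+; +-commutativeSemigroup)
open import Data.Nat.ListAction using (sum)
open import Data.Nat.ListAction.Properties using (sum-++)
open import Data.List using (List; []; _∷_; _++_; _∷ʳ_; map; zipWith; reverse; downFrom; applyDownFrom; applyUpTo)
open import Data.List.Properties using (map-++; map-∘; map-cong; zipWith-comm; applyDownFrom-∷ʳ; applyUpTo-∷ʳ; reverse-applyDownFrom)
open import Algebra.Properties.CommutativeSemigroup +-commutativeSemigroup using (x∙yz≈y∙xz)
open import Function using (_∘_)
open import Relation.Binary.PropositionalEquality using (_≡_; refl; sym; trans; cong; cong₂; module ≡-Reasoning)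
open ≡-Reasoning

sum-map-++ : ∀ {A : Set} (f : A → ℕ) xs ys → sum (map f (xs ++ ys)) ≡ sum (map f xs) + sum (map f ys)
sum-map-++ f xs ys = trans (cong sum (map-++ f xs ys)) (sum-++ (map f xs) (map f ys))

sum-map-*ˡ : ∀ {A : Set} c (f : A → ℕ) xs → sum (map (λ x → c * f x) xs) ≡ c * sum (map f xs)
sum-map-*ˡ c f []       = sym (*-zeroʳ c)
sum-map-*ˡ c f (x ∷ xs) = trans (cong (c * f x +_) (sum-map-*ˡ c f xs)) (sym (*-distribˡ-+ c (f x) _))

applyDownFrom-* : ∀ (f g : ℕ → ℕ) n →
  applyDownFrom (λ j → f j * g j) n ≡ zipWith _*_ (applyDownFrom f n) (applyDownFrom g n)
applyDownFrom-* f g zero    = refl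
applyDownFrom-* f g (suc n) = cong (f n * g n ∷_) (applyDownFrom-* f g n)

applyDownFrom-∸ : ∀ {A : Set} (f : ℕ → A) n → applyDownFrom (λ j → f (n ∸ j)) n ≡ applyUpTo (f ∘ suc) n
applyDownFrom-∸ f zero    = refl
-- The first step uses that suc n ∸ suc j computes to n ∸ j.
applyDownFrom-∸ f (suc n) = begin
  applyDownFrom (λ j → f (suc n ∸ j)) (suc n) ≡⟨ sym (applyDownFrom-∷ʳ (λ j → f (suc n ∸ j)) n) ⟩
  applyDownFrom (λ j → f (n ∸ j)) n ∷ʳ f (suc n) ≡⟨ cong (_∷ʳ f (suc n)) (applyDownFrom-∸ f n) ⟩
  applyUpTo (f ∘ suc) n ∷ʳ f (suc n)             ≡⟨ applyUpTo-∷ʳ (f ∘ suc) n ⟩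
  applyUpTo (f ∘ suc) (suc n)                    ∎

nonEmpty-++ : ∀ xss yss → nonEmpty (xss ++ yss) ≡ nonEmpty xss ++ nonEmpty yss
nonEmpty-++ []               yss = refl
nonEmpty-++ ([] ∷ xss)       yss = nonEmpty-++ xss yss
nonEmpty-++ ((x ∷ xs) ∷ xss) yss = cong ((x ∷ xs) ∷_) (nonEmpty-++ xss yss)

nonEmpty-map-∷ : ∀ x xss → nonEmpty (map (x ∷_) xss) ≡ map (x ∷_) xss
nonEmpty-map-∷ x []         = refl
nonEmpty-map-∷ x (xs ∷ xss) = cong ((x ∷ xs) ∷_) (nonEmpty-map-∷ x xss)

nonEmpty-sublists-∷ : ∀ x xs →
  nonEmpty (sublists (x ∷ xs)) ≡ map (x ∷_) (sublists xs) ++ nonEmpty (sublists xs)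
nonEmpty-sublists-∷ x xs =
  trans (nonEmpty-++ (map (x ∷_) (sublists xs)) (sublists xs))
        (cong (_++ nonEmpty (sublists xs)) (nonEmpty-map-∷ x (sublists xs)))

map-nonEmpty-cong : ∀ {A : Set} {f g : List ℕ → A} → (∀ x xs → f (x ∷ xs) ≡ g (x ∷ xs)) →
  ∀ xss → map f (nonEmpty xss) ≡ map g (nonEmpty xss)
map-nonEmpty-cong f≗g []               = refl
map-nonEmpty-cong f≗g ([] ∷ xss)       = map-nonEmpty-cong f≗g xss
map-nonEmpty-cong f≗g ((x ∷ xs) ∷ xss) = cong₂ _∷_ (f≗g x xs) (map-nonEmpty-cong f≗g xss)

sum-map-sublists : ∀ (f : List ℕ → ℕ) xs →
  sum (map f (sublists xs)) ≡ f [] + sum (map f (nonEmpty (sublists xs)))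
sum-map-sublists f []       = refl
sum-map-sublists f (x ∷ xs) = begin
  sum (map f (map (x ∷_) S ++ S))              ≡⟨ sum-map-++ f (map (x ∷_) S) S ⟩
  A + sum (map f S)                            ≡⟨ cong (A +_) (sum-map-sublists f xs) ⟩
  A + (f [] + B)                               ≡⟨ x∙yz≈y∙xz A (f []) B ⟩
  f [] + (A + B)                               ≡⟨ cong (f [] +_) (sym (sum-map-++ f (map (x ∷_) S) (nonEmpty S))) ⟩
  f [] + sum (map f (map (x ∷_) S ++ nonEmpty S))
    ≡⟨ cong (λ xss → f [] + sum (map f xss)) (sym (nonEmpty-sublists-∷ x xs)) ⟩
  f [] + sum (map f (nonEmpty (sublists (x ∷ xs)))) ∎
  where
  S = sublists xs
  A = sum (map f (map (x ∷_) S))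
  B = sum (map f (nonEmpty S))

catalansRev-applyDownFrom : ∀ (e : ℕ → ℕ) → e 0 ≡ 1 →
  (∀ m → e (suc m) ≡ sum (zipWith _*_ (applyDownFrom e (suc m)) (reverse (applyDownFrom e (suc m))))) →
  ∀ m → catalansRev m ≡ applyDownFrom e (suc m)
catalansRev-applyDownFrom e e0≡1 e-rec zero    = cong (_∷ []) (sym e0≡1)
catalansRev-applyDownFrom e e0≡1 e-rec (suc m) =
  trans (cong (λ xs → sum (zipWith _*_ xs (reverse xs)) ∷ xs) (catalansRev-applyDownFrom e e0≡1 e-rec m))
        (cong (_∷ applyDownFrom e (suc m)) (sym (e-rec m)))

d-unique : ∀ (e : ℕ → ℕ) → e 0 ≡ 1 →
  (∀ m → e (suc m) ≡ sum (zipWith _*_ (applyDownFrom e (suc m)) (reverse (applyDownFrom e (suc m))))) →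
  ∀ n → d n ≡ e n
d-unique e e0≡1 e-rec n = cong headOr0 (catalansRev-applyDownFrom e e0≡1 e-rec n)

lastFrom : ℕ → List ℕ → ℕ
lastFrom p []       = p
lastFrom p (x ∷ xs) = lastFrom x xs

lastElem-∷ : ∀ x xs → lastElem (x ∷ xs) ≡ lastFrom x xs
lastElem-∷ x []       = refl
lastElem-∷ x (y ∷ xs) = lastElem-∷ y xs

module _ (ℓ : ℕ → ℕ) where

  chainWeight : ℕ → List ℕ → ℕ
  chainWeight p σ = gapProd ℓ p σ * ℓ (lastFrom p σ)

  chainSum : ℕ → List ℕ → ℕ
  chainSum p xs = sum (map (chainWeight p) (sublists xs))

  chainSum-nonEmpty : ∀ p xs →
    chainSum p xs ≡ ℓ p + sum (map (λ σ → vecℓ ℓ p σ * ℓ (lastElem σ)) (nonEmpty (sublists xs)))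
  chainSum-nonEmpty p xs =
    trans (sum-map-sublists (chainWeight p) xs)
          (cong₂ _+_ (*-identityˡ (ℓ p)) (cong sum (map-nonEmpty-cong chainWeight-∷ (sublists xs))))
    where
    chainWeight-∷ : ∀ x τ → chainWeight p (x ∷ τ) ≡ vecℓ ℓ p (x ∷ τ) * ℓ (lastElem (x ∷ τ))
    chainWeight-∷ x τ = cong (λ q → gapProd ℓ p (x ∷ τ) * ℓ q) (sym (lastElem-∷ x τ))

  chainSum-∷ : ∀ p x xs → chainSum p (x ∷ xs) ≡ ℓ (p ∸ x) * chainSum x xs + chainSum p xs
  chainSum-∷ p x xs = trans (sum-map-++ (chainWeight p) (map (x ∷_) S) S) (cong (_+ chainSum p xs) chains-through-x)
    where
    S = sublists xs
    chains-through-x : sum (map (chainWeight p) (map (x ∷_) S)) ≡ ℓ (p ∸ x) * chainSum x xs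
    chains-through-x = begin
      sum (map (chainWeight p) (map (x ∷_) S))   ≡⟨ cong sum (sym (map-∘ S)) ⟩
      sum (map (chainWeight p ∘ (x ∷_)) S)
        ≡⟨ cong sum (map-cong (λ τ → *-assoc (ℓ (p ∸ x)) (gapProd ℓ x τ) (ℓ (lastFrom x τ))) S) ⟩
      sum (map (λ τ → ℓ (p ∸ x) * chainWeight x τ) S) ≡⟨ sum-map-*ˡ (ℓ (p ∸ x)) (chainWeight x) S ⟩
      ℓ (p ∸ x) * chainSum x xs                  ∎

  module _ (ℓ1≡1 : ℓ 1 ≡ 1) (ℓ-rec : ∀ n → n ≥ 1 → ℓ (suc n) ≡ ℓ n + decSum ℓ n) where

    chainSum-downFrom : ∀ m → chainSum (suc m) (map suc (downFrom m)) ≡ ℓ (suc (suc m))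
    chainSum-downFrom m = trans (chainSum-nonEmpty (suc m) (map suc (downFrom m))) (sym (ℓ-rec (suc m) (s≤s z≤n)))

    chainSum-convolution : ∀ p m →
      chainSum p (map suc (downFrom m)) ≡ sum (applyDownFrom (λ j → ℓ (p ∸ j) * ℓ (suc j)) (suc m))
    chainSum-convolution p zero    =
      cong (_+ 0) (trans (*-identityˡ (ℓ p)) (sym (trans (cong (ℓ p *_) ℓ1≡1) (*-identityʳ (ℓ p)))))
    chainSum-convolution p (suc m) =
      trans (chainSum-∷ p (suc m) (map suc (downFrom m)))
            (cong₂ _+_ (cong (ℓ (p ∸ suc m) *_) (chainSum-downFrom m)) (chainSum-convolution p m))

    ℓ-catalan-rec : ∀ m → ℓ (suc (suc m)) ≡
      sum (zipWith _*_ (applyDownFrom (ℓ ∘ suc) (suc m)) (reverse (applyDownFrom (ℓ ∘ suc) (suc m))))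
    ℓ-catalan-rec m = begin
      ℓ (suc (suc m))                                  ≡⟨ sym (chainSum-downFrom m) ⟩
      chainSum (suc m) (map suc (downFrom m))          ≡⟨ chainSum-convolution (suc m) m ⟩
      sum (applyDownFrom (λ j → ℓ (suc m ∸ j) * ℓ (suc j)) (suc m))
        ≡⟨ cong sum (applyDownFrom-* (λ j → ℓ (suc m ∸ j)) (ℓ ∘ suc) (suc m)) ⟩
      sum (zipWith _*_ (applyDownFrom (λ j → ℓ (suc m ∸ j)) (suc m)) ys)
        ≡⟨ cong (λ zs → sum (zipWith _*_ zs ys)) reverse-ys ⟩
      sum (zipWith _*_ (reverse ys) ys)        ≡⟨ cong sum (zipWith-comm _*_ *-comm (reverse ys) ys) ⟩
      sum (zipWith _*_ ys (reverse ys))        ∎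
      where
      ys : List ℕ
      ys = applyDownFrom (ℓ ∘ suc) (suc m)
      reverse-ys : applyDownFrom (λ j → ℓ (suc m ∸ j)) (suc m) ≡ reverse ys
      reverse-ys = trans (applyDownFrom-∸ ℓ (suc m)) (sym (reverse-applyDownFrom (ℓ ∘ suc) (suc m)))

corollary4p17 : (ℓ : ℕ → ℕ) → ℓ 1 ≡ 1
    → (∀ n → n ≥ 1 → ℓ (suc n) ≡ ℓ n + decSum ℓ n)
    → ∀ n → d n ≡ ℓ (suc n)
corollary4p17 ℓ ℓ1≡1 ℓ-rec = d-unique (ℓ ∘ suc) ℓ1≡1 (ℓ-catalan-rec ℓ ℓ1≡1 ℓ-rec)
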